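{- If $n$ is a non-negative integer, then \[ \sum_{k = 1}^n \sum_{j = 0}^{k - 1} \frac{( - 1)^j }{n - j}\binom{n}{j}^3 = \begin{cases} ( - 1)^{n/2} \binom{n}{n/2}\binom{3n/2}{n}-1,&\text{if $n$ is even;} \\ 1,&\text{if $n$ is odd.} \end{cases} \]
   Context: Empty sums are $0$. -}

module Defs where

open import Data.Nat using (ℕ; zero; suc; _+_; _∸_) renaming (_*_ to _*ℕ_)
open import Data.Integer using (ℤ; +_; -1ℤ) renaming (_*_ to _*ℤ_; _^_ to _^ℤ_)
open import Data.Rational using (ℚ; 0ℚ; _/_) renaming (_+_ to _+ℚ_)
open import Data.Nat.Combinatorics using (_C_)

sumBelow : ℕ → (ℕ → ℚ) → ℚ
sumBelow zero    f = 0ℚ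
sumBelow (suc n) f = sumBelow n f +ℚ f n

-- Σ_{i = a}^{b} f i  (inclusive bounds; empty, i.e. 0, when b < a)
sumFromTo : ℕ → ℕ → (ℕ → ℚ) → ℚ
sumFromTo a b f = sumBelow (suc b ∸ a) (λ i → f (a + i))

-- z / d as a rational; the value at d = 0 is an arbitrary convention (0)
-- and is never used in the statement, where the denominator is n - j ≥ 1.
frac : ℤ → ℕ → ℚ
frac z zero    = 0ℚ
frac z (suc d) = z / suc d

term : ℕ → ℕ → ℚ
term n j = frac ((-1ℤ ^ℤ j) *ℤ (+ ((n C j) *ℕ (n C j) *ℕ (n C j)))) (n ∸ j)

S : ℕ → ℚ
S n = sumFromTo 1 n (λ k → sumFromTo 0 (k ∸ 1) (λ j → term n j))

{-# OPTIONS --safe #-}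
-- Exchanging the order of summation, the term with index j occurs n - j times, which cancels
-- its denominator: S n = Σ_{j<n} f n j = a n - (-1)^n, where f n j = (-1)^j C(n,j)³ and
-- a n = Σ_{j≤n} f n j is Dixon's sum. The WZ-style certificate G n j = (-1)^j C(n+1,j)³ W(n+1,j)
-- satisfies, for every j,
--   (n+1)³ ((n+2)² f (n+2) (j+1) + 3(3n+2)(3n+4) f n j) = G n (j+1) - G n j,
-- so summing over j telescopes to the recurrence (n+2)² a (n+2) = -3(3n+2)(3n+4) a n.
-- Since a 1 = 0 the odd values vanish, and (-1)^m C(2m,m) C(3m,2m) = (-1)^m (3m)!/(m!)³
-- satisfies the same recurrence along the even values, starting from a 0 = 1.
module Submission where

open import Algebra.Bundles using (CommutativeMonoid; Semiring)
open import Data.List.Base using (_∷_; [])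
open import Function.Base using (_∘_)

open import Defs

module CommutativeMonoidSum {c ℓ} (M : CommutativeMonoid c ℓ) where

  open import Data.Nat.Base as ℕ using (ℕ; zero; suc; _∸_)
  open import Data.Nat.Properties using (m<n⇒m<1+n; n<1+n; <⇒≤; +-∸-assoc; m+n∸n≡m)
  open CommutativeMonoid M
  open import Algebra.Definitions.RawMonoid rawMonoid public using (_×_)
  open import Algebra.Properties.CommutativeSemigroup commutativeSemigroup using (interchange)
  import Relation.Binary.PropositionalEquality as ≡
  open import Relation.Binary.Reasoning.Setoid setoid

  ∑< : ℕ → (ℕ → Carrier) → Carrier
  ∑< zero    f = ε
  ∑< (suc n) f = ∑< n f ∙ f n

  syntax ∑< n (λ j → f) = ∑[ j < n ] f

  ∑<-cong : ∀ n {f g} → (∀ {j} → j ℕ.< n → f j ≈ g j) → ∑< n f ≈ ∑< n g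
  ∑<-cong zero    f≈g = refl
  ∑<-cong (suc n) f≈g = ∙-cong (∑<-cong n (f≈g ∘ m<n⇒m<1+n)) (f≈g (n<1+n n))

  ∑<-distrib-∙ : ∀ n f g → ∑[ j < n ] (f j ∙ g j) ≈ ∑< n f ∙ ∑< n g
  ∑<-distrib-∙ zero    f g = sym (identityˡ ε)
  ∑<-distrib-∙ (suc n) f g = trans (∙-congʳ (∑<-distrib-∙ n f g)) (interchange _ _ _ _)

  ∑<-suc : ∀ n f → ∑< (suc n) f ≈ f 0 ∙ ∑< n (f ∘ suc)
  ∑<-suc zero    f = comm ε (f 0)
  ∑<-suc (suc n) f = trans (∙-congʳ (∑<-suc n f)) (assoc _ _ _)

  ∑<-telescope : ∀ (g h : ℕ → Carrier) → (∀ j → g (suc j) ≈ g j ∙ h j) → ∀ n → g 0 ∙ ∑< n h ≈ g n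
  ∑<-telescope g h step zero    = identityʳ (g 0)
  ∑<-telescope g h step (suc n) = begin
    g 0 ∙ (∑< n h ∙ h n) ≈⟨ assoc _ _ _ ⟨
    (g 0 ∙ ∑< n h) ∙ h n ≈⟨ ∙-congʳ (∑<-telescope g h step n) ⟩
    g n ∙ h n            ≈⟨ step n ⟨
    g (suc n)            ∎

  ∑<-triangle : ∀ n t → ∑[ k < n ] ∑< (suc k) t ≈ ∑[ j < n ] ((n ∸ j) × t j)
  ∑<-triangle zero    t = refl
  ∑<-triangle (suc n) t = begin
    ∑[ k < n ] ∑< (suc k) t ∙ (∑< n t ∙ t n)      ≈⟨ ∙-congʳ (∑<-triangle n t) ⟩
    ∑[ j < n ] ((n ∸ j) × t j) ∙ (∑< n t ∙ t n)   ≈⟨ assoc _ _ _ ⟨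
    (∑[ j < n ] ((n ∸ j) × t j) ∙ ∑< n t) ∙ t n   ≈⟨ ∙-congʳ (∑<-distrib-∙ n _ t) ⟨
    ∑[ j < n ] ((n ∸ j) × t j ∙ t j) ∙ t n        ≈⟨ ∙-cong (∑<-cong n one-more) last ⟩
    ∑[ j < suc n ] ((suc n ∸ j) × t j)            ∎
    where
    one-more : ∀ {j} → j ℕ.< n → (n ∸ j) × t j ∙ t j ≈ (suc n ∸ j) × t j
    one-more {j} j<n = begin
      (n ∸ j) × t j ∙ t j ≈⟨ comm _ _ ⟩
      suc (n ∸ j) × t j   ≡⟨ ≡.cong (_× t j) (+-∸-assoc 1 (<⇒≤ j<n)) ⟨
      (suc n ∸ j) × t j   ∎
    last : t n ≈ (suc n ∸ n) × t n
    last = begin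
      t n               ≈⟨ identityʳ (t n) ⟨
      1 × t n           ≡⟨ ≡.cong (_× t n) (m+n∸n≡m 1 n) ⟨
      (suc n ∸ n) × t n ∎

module SemiringSum {c ℓ} (R : Semiring c ℓ) where

  open import Data.Nat.Base using (ℕ; zero; suc)
  open Semiring R
  open CommutativeMonoidSum +-commutativeMonoid public

  *-distribˡ-∑< : ∀ x n f → x * ∑< n f ≈ ∑[ j < n ] (x * f j)
  *-distribˡ-∑< x zero    f = zeroʳ x
  *-distribˡ-∑< x (suc n) f = trans (distribˡ x (∑< n f) (f n)) (+-congʳ (*-distribˡ-∑< x n f))

module _ where

  open import Data.Nat.Base using (ℕ; zero; suc; _+_; _*_; _∸_; _≤_; _!; s≤s; s<s)
  open import Data.Nat.Properties
    using (_≤?_; ≰⇒>; *-cancelˡ-≡; *-comm; *-zeroʳ; *-distribˡ-+; +-comm; +-identityʳ; *-identityˡ; *-suc;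
           m+n∸m≡n; m+n∸n≡m; m≤m+n; m≤n+m; m*n≢0; _!≢0; _!*_!≢0)
  open import Data.Nat.Combinatorics
    using (_C_; nCk≡n!/k![n-k]!; k![n∸k]!∣n!; k>n⇒nCk≡0; nCk+nC[k+1]≡[n+1]C[k+1])
  open import Data.Nat.DivMod using (_/_; m*[n/m]≡n)
  open import Data.Nat.Tactic.RingSolver using (solve-∀)
  open import Relation.Binary.PropositionalEquality using (_≡_; sym; trans; cong; module ≡-Reasoning)
  open import Relation.Nullary.Decidable using (yes; no)
  open ≡-Reasoning

  k![n∸k]!*nCk≡n! : ∀ {n k} → k ≤ n → k ! * (n ∸ k) ! * (n C k) ≡ n !
  k![n∸k]!*nCk≡n! {n} {k} k≤n = begin
    k ! * (n ∸ k) ! * (n C k)                   ≡⟨ cong (k ! * (n ∸ k) ! *_) (nCk≡n!/k![n-k]! k≤n) ⟩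
    k ! * (n ∸ k) ! * (n ! / (k ! * (n ∸ k) !)) ≡⟨ m*[n/m]≡n (k![n∸k]!∣n! k≤n) ⟩
    n !                                         ∎
    where instance _ = k !* (n ∸ k) !≢0

  [n+1]C[k+1]*[k+1]≡[n+1]*nCk : ∀ n k → (suc n C suc k) * suc k ≡ suc n * (n C k)
  [n+1]C[k+1]*[k+1]≡[n+1]*nCk n k with k ≤? n
  ... | no k≰n = begin
    (suc n C suc k) * suc k ≡⟨ cong (_* suc k) (k>n⇒nCk≡0 (s<s (≰⇒> k≰n))) ⟩
    0                       ≡⟨ *-zeroʳ (suc n) ⟨
    suc n * 0               ≡⟨ cong (suc n *_) (k>n⇒nCk≡0 (≰⇒> k≰n)) ⟨
    suc n * (n C k)         ∎
  ... | yes k≤n = *-cancelˡ-≡ _ _ (k ! * (n ∸ k) !) (begin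
    k ! * (n ∸ k) ! * ((suc n C suc k) * suc k) ≡⟨ pull-left (k !) ((n ∸ k) !) (suc n C suc k) (suc k) ⟩
    (suc k) ! * (n ∸ k) ! * (suc n C suc k)     ≡⟨ k![n∸k]!*nCk≡n! (s≤s k≤n) ⟩
    suc n * n !                                 ≡⟨ cong (suc n *_) (k![n∸k]!*nCk≡n! k≤n) ⟨
    suc n * (k ! * (n ∸ k) ! * (n C k))         ≡⟨ push-right (k !) ((n ∸ k) !) (n C k) (suc n) ⟩
    k ! * (n ∸ k) ! * (suc n * (n C k))         ∎)
    where
    instance _ = k !* (n ∸ k) !≢0
    pull-left : ∀ a b c m → a * b * (c * m) ≡ m * a * b * c
    pull-left = solve-∀
    push-right : ∀ a b c m → m * (a * b * c) ≡ a * b * (m * c)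
    push-right = solve-∀

  nCk*[n+1]+[n+1]Ck*k≡[n+1]Ck*[n+1] : ∀ n k → (n C k) * suc n + (suc n C k) * k ≡ (suc n C k) * suc n
  nCk*[n+1]+[n+1]Ck*k≡[n+1]Ck*[n+1] n zero    = +-identityʳ (1 * suc n)
  nCk*[n+1]+[n+1]Ck*k≡[n+1]Ck*[n+1] n (suc k) = begin
    (n C suc k) * suc n + (suc n C suc k) * suc k
      ≡⟨ cong ((n C suc k) * suc n +_) ([n+1]C[k+1]*[k+1]≡[n+1]*nCk n k) ⟩
    (n C suc k) * suc n + suc n * (n C k)
      ≡⟨ cong (_+ suc n * (n C k)) (*-comm (n C suc k) (suc n)) ⟩
    suc n * (n C suc k) + suc n * (n C k)
      ≡⟨ *-distribˡ-+ (suc n) (n C suc k) (n C k) ⟨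
    suc n * (n C suc k + n C k)
      ≡⟨ cong (suc n *_) (trans (+-comm (n C suc k) (n C k)) (nCk+nC[k+1]≡[n+1]C[k+1] n k)) ⟩
    suc n * (suc n C suc k)
      ≡⟨ *-comm (suc n) (suc n C suc k) ⟩
    (suc n C suc k) * suc n ∎

  trinomial : ℕ → ℕ
  trinomial m = ((2 * m) C m) * ((3 * m) C (2 * m))

  m!³*trinomial≡[3m]! : ∀ m → m ! * m ! * m ! * trinomial m ≡ (3 * m) !
  m!³*trinomial≡[3m]! m = begin
    m ! * m ! * m ! * (((2 * m) C m) * ((3 * m) C (2 * m)))
      ≡⟨ regroup (m !) (m !) (m !) ((2 * m) C m) ((3 * m) C (2 * m)) ⟩
    m ! * m ! * ((2 * m) C m) * m ! * ((3 * m) C (2 * m))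
      ≡⟨ cong (λ k → m ! * k ! * ((2 * m) C m) * m ! * ((3 * m) C (2 * m))) 2m∸m≡m ⟨
    m ! * (2 * m ∸ m) ! * ((2 * m) C m) * m ! * ((3 * m) C (2 * m))
      ≡⟨ cong (λ x → x * m ! * ((3 * m) C (2 * m))) (k![n∸k]!*nCk≡n! (m≤m+n m (1 * m))) ⟩
    (2 * m) ! * m ! * ((3 * m) C (2 * m))
      ≡⟨ cong (λ k → (2 * m) ! * k ! * ((3 * m) C (2 * m))) (m+n∸n≡m m (2 * m)) ⟨
    (2 * m) ! * (3 * m ∸ 2 * m) ! * ((3 * m) C (2 * m))
      ≡⟨ k![n∸k]!*nCk≡n! (m≤n+m (2 * m) m) ⟩
    (3 * m) ! ∎
    where
    2m∸m≡m : 2 * m ∸ m ≡ m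
    2m∸m≡m = trans (m+n∸m≡n m (1 * m)) (*-identityˡ m)
    regroup : ∀ a b c x y → a * b * c * (x * y) ≡ a * b * x * c * y
    regroup = solve-∀

  trinomial-recurrence : ∀ m → suc m * suc m * trinomial (suc m) ≡ 3 * suc (3 * m) * suc (suc (3 * m)) * trinomial m
  trinomial-recurrence m = *-cancelˡ-≡ _ _ (suc m * (m ! * m ! * m !)) (begin
    suc m * (m ! * m ! * m !) * (suc m * suc m * trinomial (suc m))
      ≡⟨ regroup m (m !) (trinomial (suc m)) ⟩
    (suc m) ! * (suc m) ! * (suc m) ! * trinomial (suc m)
      ≡⟨ m!³*trinomial≡[3m]! (suc m) ⟩
    (3 * suc m) !
      ≡⟨ cong _! (*-suc 3 m) ⟩
    (3 + 3 * m) * ((2 + 3 * m) * ((1 + 3 * m) * (3 * m) !))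
      ≡⟨ cong (λ x → (3 + 3 * m) * ((2 + 3 * m) * ((1 + 3 * m) * x))) (m!³*trinomial≡[3m]! m) ⟨
    (3 + 3 * m) * ((2 + 3 * m) * ((1 + 3 * m) * (m ! * m ! * m ! * trinomial m)))
      ≡⟨ regroup′ m (m !) (trinomial m) ⟩
    suc m * (m ! * m ! * m !) * (3 * suc (3 * m) * suc (suc (3 * m)) * trinomial m) ∎)
    where
    instance
      m!≢0      = m !≢0
      m!²≢0     = m*n≢0 (m !) (m !)
      m!³≢0     = m*n≢0 (m ! * m !) (m !)
      [1+m]m!³≢0 = m*n≢0 (suc m) (m ! * m ! * m !)
    regroup : ∀ m a t → suc m * (a * a * a) * (suc m * suc m * t) ≡ (suc m * a) * (suc m * a) * (suc m * a) * t
    regroup = solve-∀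
    regroup′ : ∀ m a t → (3 + 3 * m) * ((2 + 3 * m) * ((1 + 3 * m) * (a * a * a * t)))
                         ≡ suc m * (a * a * a) * (3 * suc (3 * m) * suc (suc (3 * m)) * t)
    regroup′ = solve-∀

module _ where

  open import Data.Nat.Base as ℕ using (ℕ; zero; suc)
  import Data.Nat.Properties as ℕ
  open import Data.Nat.Combinatorics using (_C_; k>n⇒nCk≡0; nCn≡1)
  open import Data.Integer.Base using (ℤ; +_; -_; _+_; _-_; _*_; _^_; 0ℤ; 1ℤ; -1ℤ; NonZero)
  open import Data.Integer.Properties
    using (pos-*; pos-+; *-cancelˡ-≡; *-comm; *-zeroʳ; *-identityˡ; *-identityʳ; +-identityʳ; +-assoc;
           +-inverseʳ; ^-*-assoc; ^-zeroˡ; i*j≢0; +-*-semiring)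
  open import Data.Integer.Tactic.RingSolver using (solve)
  open import Relation.Binary.PropositionalEquality using (_≡_; refl; sym; trans; cong; cong₂; module ≡-Reasoning)
  open ≡-Reasoning
  open SemiringSum +-*-semiring

  pos-*-≡ : ∀ a b c d → a ℕ.* b ≡ c ℕ.* d → + a * + b ≡ + c * + d
  pos-*-≡ a b c d eq = trans (sym (pos-* a b)) (trans (cong +_ eq) (pos-* c d))

  pos-cube : ∀ k → + (k ℕ.* k ℕ.* k) ≡ + k * + k * + k
  pos-cube k = trans (pos-* (k ℕ.* k) k) (cong (_* + k) (pos-* k k))

  W : ℤ → ℤ → ℤ
  W q x = q * q * q * ((1ℤ + q) * (1ℤ + q)) + + 3 * (q * q) * (1ℤ + q) * t + + 3 * (+ 3 * q + 1ℤ) * (t * t)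
    where t = x * (q - x)

  W-at-0 : ∀ q → W q 0ℤ ≡ q * q * q * ((1ℤ + q) * (1ℤ + q))
  W-at-0 q = begin
    W q 0ℤ
      ≡⟨⟩
    q * q * q * ((1ℤ + q) * (1ℤ + q)) + + 3 * (q * q) * (1ℤ + q) * 0ℤ + + 3 * (+ 3 * q + 1ℤ) * (0ℤ * 0ℤ)
      ≡⟨ solve (q ∷ []) ⟩
    q * q * q * ((1ℤ + q) * (1ℤ + q)) ∎

  W-telescopes : ∀ q x →
    (1ℤ + q) * (1ℤ + q) * ((1ℤ + q) * (1ℤ + q) * (1ℤ + q)) * (q * q * q)
      - + 3 * (+ 3 * q - 1ℤ) * (+ 3 * q + 1ℤ) * ((1ℤ + x) * (1ℤ + x) * (1ℤ + x)) * ((q - x) * (q - x) * (q - x))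
    ≡ (q - x) * (q - x) * (q - x) * W q (1ℤ + x) + (1ℤ + x) * (1ℤ + x) * (1ℤ + x) * W q x
  W-telescopes q x = begin
    (1ℤ + q) * (1ℤ + q) * ((1ℤ + q) * (1ℤ + q) * (1ℤ + q)) * (q * q * q)
      - + 3 * (+ 3 * q - 1ℤ) * (+ 3 * q + 1ℤ) * ((1ℤ + x) * (1ℤ + x) * (1ℤ + x)) * ((q - x) * (q - x) * (q - x))
      ≡⟨ solve (q ∷ x ∷ []) ⟩
    (q - x) * (q - x) * (q - x)
      * (q * q * q * ((1ℤ + q) * (1ℤ + q)) + + 3 * (q * q) * (1ℤ + q) * ((1ℤ + x) * (q - (1ℤ + x)))
         + + 3 * (+ 3 * q + 1ℤ) * (((1ℤ + x) * (q - (1ℤ + x))) * ((1ℤ + x) * (q - (1ℤ + x)))))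
    + (1ℤ + x) * (1ℤ + x) * (1ℤ + x)
      * (q * q * q * ((1ℤ + q) * (1ℤ + q)) + + 3 * (q * q) * (1ℤ + q) * (x * (q - x))
         + + 3 * (+ 3 * q + 1ℤ) * ((x * (q - x)) * (x * (q - x))))
      ≡⟨⟩
    (q - x) * (q - x) * (q - x) * W q (1ℤ + x) + (1ℤ + x) * (1ℤ + x) * (1ℤ + x) * W q x ∎

  -- Multiplying through by p³ q³ turns a, b and d into multiples of c.
  cubes-step : ∀ p q r s e k a b c d u v .{{_ : NonZero p}} .{{_ : NonZero q}} →
    a * p ≡ s * c → b * q ≡ c * r → d * p ≡ q * b →
    e * (s * s * s) * (q * q * q) - k * (p * p * p) * (r * r * r) ≡ r * r * r * u + p * p * p * v →
    q * q * q * (e * (a * a * a) - k * (b * b * b)) ≡ d * d * d * u + c * c * c * v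
  cubes-step p q r s e k a b c d u v ap≡sc bq≡cr dp≡qb key = *-cancelˡ-≡ (p * p * p * (q * q * q)) _ _ (begin
    p * p * p * (q * q * q) * (q * q * q * (e * (a * a * a) - k * (b * b * b)))
      ≡⟨ solve (p ∷ q ∷ e ∷ k ∷ a ∷ b ∷ []) ⟩
    q * q * q * (e * ((a * p) * (a * p) * (a * p)) * (q * q * q) - k * (p * p * p) * ((b * q) * (b * q) * (b * q)))
      ≡⟨ cong₂ (λ x y → q * q * q * (e * (x * x * x) * (q * q * q) - k * (p * p * p) * (y * y * y))) ap≡sc bq≡cr ⟩
    q * q * q * (e * ((s * c) * (s * c) * (s * c)) * (q * q * q) - k * (p * p * p) * ((c * r) * (c * r) * (c * r)))
      ≡⟨ solve (p ∷ q ∷ r ∷ s ∷ e ∷ k ∷ c ∷ []) ⟩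
    q * q * q * (c * c * c) * (e * (s * s * s) * (q * q * q) - k * (p * p * p) * (r * r * r))
      ≡⟨ cong (q * q * q * (c * c * c) *_) key ⟩
    q * q * q * (c * c * c) * (r * r * r * u + p * p * p * v)
      ≡⟨ solve (p ∷ q ∷ r ∷ c ∷ u ∷ v ∷ []) ⟩
    (c * r) * (c * r) * (c * r) * (q * q * q) * u + p * p * p * (q * q * q) * (c * c * c * v)
      ≡⟨ cong (λ x → x * x * x * (q * q * q) * u + p * p * p * (q * q * q) * (c * c * c * v)) cr≡dp ⟩
    (d * p) * (d * p) * (d * p) * (q * q * q) * u + p * p * p * (q * q * q) * (c * c * c * v)
      ≡⟨ solve (p ∷ q ∷ c ∷ d ∷ u ∷ v ∷ []) ⟩
    p * p * p * (q * q * q) * (d * d * d * u + c * c * c * v) ∎)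
    where
    instance
      p³≢0   = i*j≢0 (p * p) p {{i*j≢0 p p}}
      q³≢0   = i*j≢0 (q * q) q {{i*j≢0 q q}}
      p³q³≢0 = i*j≢0 (p * p * p) (q * q * q)
    cr≡dp : c * r ≡ d * p
    cr≡dp = trans (sym bq≡cr) (trans (*-comm b q) (sym dp≡qb))

  wz-step : ∀ σ q x a b c d .{{_ : NonZero q}} .{{_ : NonZero (1ℤ + x)}} →
    a * (1ℤ + x) ≡ (1ℤ + q) * c → b * q ≡ c * (q - x) → d * (1ℤ + x) ≡ q * b →
    -1ℤ * σ * (d * d * d) * W q (1ℤ + x) ≡ σ * (c * c * c) * W q x +
      q * q * q * ((1ℤ + q) * (1ℤ + q) * (-1ℤ * σ * (a * a * a))
                   + + 3 * (+ 3 * q - 1ℤ) * (+ 3 * q + 1ℤ) * (σ * (b * b * b)))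
  wz-step σ q x a b c d h₁ h₂ h₃ =
    flip-sign (q * q * q) ((1ℤ + q) * (1ℤ + q)) (+ 3 * (+ 3 * q - 1ℤ) * (+ 3 * q + 1ℤ))
              (a * a * a) (b * b * b) (d * d * d) (c * c * c) (W q (1ℤ + x)) (W q x)
      (cubes-step (1ℤ + x) q (q - x) (1ℤ + q) ((1ℤ + q) * (1ℤ + q)) (+ 3 * (+ 3 * q - 1ℤ) * (+ 3 * q + 1ℤ))
                  a b c d (W q (1ℤ + x)) (W q x) h₁ h₂ h₃ (W-telescopes q x))
    where
    flip-sign : ∀ Q α κ a³ b³ d³ c³ u v → Q * (α * a³ - κ * b³) ≡ d³ * u + c³ * v →
      -1ℤ * σ * d³ * u ≡ σ * c³ * v + Q * (α * (-1ℤ * σ * a³) + κ * (σ * b³))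
    flip-sign Q α κ a³ b³ d³ c³ u v eq = begin
      -1ℤ * σ * d³ * u                                     ≡⟨ solve (σ ∷ c³ ∷ d³ ∷ u ∷ v ∷ []) ⟩
      σ * c³ * v - σ * (d³ * u + c³ * v)                   ≡⟨ cong (λ z → σ * c³ * v - σ * z) eq ⟨
      σ * c³ * v - σ * (Q * (α * a³ - κ * b³))             ≡⟨ solve (σ ∷ Q ∷ α ∷ κ ∷ a³ ∷ b³ ∷ c³ ∷ v ∷ []) ⟩
      σ * c³ * v + Q * (α * (-1ℤ * σ * a³) + κ * (σ * b³)) ∎

  dixonTerm : ℕ → ℕ → ℤ
  dixonTerm n j = -1ℤ ^ j * (+ (n C j) * + (n C j) * + (n C j))

  dixonSum : ℕ → ℤ
  dixonSum n = ∑< (suc n) (dixonTerm n)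

  dixonTerm-beyond : ∀ {n j} → n ℕ.< j → dixonTerm n j ≡ 0ℤ
  dixonTerm-beyond {n} {j} n<j = begin
    -1ℤ ^ j * (+ (n C j) * + (n C j) * + (n C j)) ≡⟨ cong (λ z → -1ℤ ^ j * (+ z * + z * + z)) (k>n⇒nCk≡0 n<j) ⟩
    -1ℤ ^ j * 0ℤ                                  ≡⟨ *-zeroʳ (-1ℤ ^ j) ⟩
    0ℤ                                            ∎

  -- κ n = 3(3n+2)(3n+4), written in q = n + 1 to match W-telescopes.
  α κ : ℕ → ℤ
  α n = + suc (suc n) * + suc (suc n)
  κ n = + 3 * (+ 3 * + suc n - 1ℤ) * (+ 3 * + suc n + 1ℤ)

  certificate : ℕ → ℕ → ℤ
  certificate n j = -1ℤ ^ j * (+ (suc n C j) * + (suc n C j) * + (suc n C j)) * W (+ suc n) (+ j)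

  certificate-step : ∀ n j → let q = + suc n in
    certificate n (suc j) ≡ certificate n j + q * q * q * (α n * dixonTerm (2 ℕ.+ n) (suc j) + κ n * dixonTerm n j)
  certificate-step n j = wz-step (-1ℤ ^ j) q (+ j) a b c d ap≡sc (bq≡c[q-x] b c q (+ j) bq+cx≡cq) dp≡qb
    where
    q = + suc n
    a = + (suc (suc n) C suc j)
    b = + (n C j)
    c = + (suc n C j)
    d = + (suc n C suc j)
    ap≡sc : a * + suc j ≡ + suc (suc n) * c
    ap≡sc = pos-*-≡ (suc (suc n) C suc j) (suc j) (suc (suc n)) (suc n C j)
                    ([n+1]C[k+1]*[k+1]≡[n+1]*nCk (suc n) j)
    dp≡qb : d * + suc j ≡ q * b
    dp≡qb = pos-*-≡ (suc n C suc j) (suc j) (suc n) (n C j) ([n+1]C[k+1]*[k+1]≡[n+1]*nCk n j)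
    bq+cx≡cq : b * q + c * + j ≡ c * q
    bq+cx≡cq = begin
      b * q + c * + j                                 ≡⟨ cong₂ _+_ (pos-* (n C j) (suc n)) (pos-* (suc n C j) j) ⟨
      + ((n C j) ℕ.* suc n) + + ((suc n C j) ℕ.* j)   ≡⟨ pos-+ ((n C j) ℕ.* suc n) ((suc n C j) ℕ.* j) ⟨
      + ((n C j) ℕ.* suc n ℕ.+ (suc n C j) ℕ.* j)     ≡⟨ cong +_ (nCk*[n+1]+[n+1]Ck*k≡[n+1]Ck*[n+1] n j) ⟩
      + ((suc n C j) ℕ.* suc n)                       ≡⟨ pos-* (suc n C j) (suc n) ⟩
      c * q                                           ∎
    bq≡c[q-x] : ∀ b c q x → b * q + c * x ≡ c * q → b * q ≡ c * (q - x)
    bq≡c[q-x] b c q x eq = begin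
      b * q                 ≡⟨ solve (b ∷ c ∷ q ∷ x ∷ []) ⟩
      b * q + c * x - c * x ≡⟨ cong (_- c * x) eq ⟩
      c * q - c * x         ≡⟨ solve (c ∷ q ∷ x ∷ []) ⟩
      c * (q - x)           ∎

  dixonSum-recurrence : ∀ n → α n * dixonSum (2 ℕ.+ n) ≡ - κ n * dixonSum n
  dixonSum-recurrence n = begin
    α n * dixonSum (2 ℕ.+ n) ≡⟨ cong (α n *_) (∑<-suc (2 ℕ.+ n) (dixonTerm (2 ℕ.+ n))) ⟩
    α n * (1ℤ + T)           ≡⟨ cancel-q³ (q * q * q) (α n) (κ n) T (dixonSum n) telescoped ⟩
    - κ n * dixonSum n       ∎
    where
    q = + suc n
    T = ∑< (2 ℕ.+ n) (dixonTerm (2 ℕ.+ n) ∘ suc)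
    step : ℕ → ℤ
    step j = q * q * q * (α n * dixonTerm (2 ℕ.+ n) (suc j) + κ n * dixonTerm n j)
    sum-of-steps : ∑< (2 ℕ.+ n) step ≡ q * q * q * (α n * T + κ n * dixonSum n)
    sum-of-steps = begin
      ∑< (2 ℕ.+ n) step
        ≡⟨ *-distribˡ-∑< (q * q * q) (2 ℕ.+ n) _ ⟨
      q * q * q * ∑[ j < 2 ℕ.+ n ] (α n * dixonTerm (2 ℕ.+ n) (suc j) + κ n * dixonTerm n j)
        ≡⟨ cong (q * q * q *_) (∑<-distrib-∙ (2 ℕ.+ n) _ _) ⟩
      q * q * q * (∑[ j < 2 ℕ.+ n ] (α n * dixonTerm (2 ℕ.+ n) (suc j)) + ∑[ j < 2 ℕ.+ n ] (κ n * dixonTerm n j))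
        ≡⟨ cong (q * q * q *_) (cong₂ _+_ (*-distribˡ-∑< (α n) (2 ℕ.+ n) _) (*-distribˡ-∑< (κ n) (2 ℕ.+ n) _)) ⟨
      q * q * q * (α n * T + κ n * (dixonSum n + dixonTerm n (suc n)))
        ≡⟨ cong (λ z → q * q * q * (α n * T + κ n * (dixonSum n + z))) (dixonTerm-beyond (ℕ.n<1+n n)) ⟩
      q * q * q * (α n * T + κ n * (dixonSum n + 0ℤ))
        ≡⟨ cong (λ z → q * q * q * (α n * T + κ n * z)) (+-identityʳ (dixonSum n)) ⟩
      q * q * q * (α n * T + κ n * dixonSum n) ∎
    telescoped : q * q * q * α n + q * q * q * (α n * T + κ n * dixonSum n) ≡ 0ℤ
    telescoped = begin
      q * q * q * α n + q * q * q * (α n * T + κ n * dixonSum n)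
        ≡⟨ cong₂ _+_ (trans (*-identityˡ _) (W-at-0 q)) sum-of-steps ⟨
      certificate n 0 + ∑< (2 ℕ.+ n) step
        ≡⟨ ∑<-telescope (certificate n) step (certificate-step n) (2 ℕ.+ n) ⟩
      certificate n (2 ℕ.+ n)
        ≡⟨ cong (λ z → -1ℤ ^ (2 ℕ.+ n) * (+ z * + z * + z) * W q (+ (2 ℕ.+ n))) (k>n⇒nCk≡0 (ℕ.n<1+n (suc n))) ⟩
      -1ℤ ^ (2 ℕ.+ n) * 0ℤ * W q (+ (2 ℕ.+ n))
        ≡⟨ cong (_* W q (+ (2 ℕ.+ n))) (*-zeroʳ (-1ℤ ^ (2 ℕ.+ n))) ⟩
      0ℤ ∎
    cancel-q³ : ∀ Q a k t A .{{_ : NonZero Q}} → Q * a + Q * (a * t + k * A) ≡ 0ℤ → a * (1ℤ + t) ≡ - k * A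
    cancel-q³ Q a k t A eq = *-cancelˡ-≡ Q _ _ (begin
      Q * (a * (1ℤ + t))                        ≡⟨ solve (Q ∷ a ∷ k ∷ t ∷ A ∷ []) ⟩
      Q * a + Q * (a * t + k * A) - Q * (k * A) ≡⟨ cong (_- Q * (k * A)) eq ⟩
      0ℤ - Q * (k * A)                          ≡⟨ solve (Q ∷ k ∷ A ∷ []) ⟩
      Q * (- k * A)                             ∎)

  recurrence-unique : ∀ (c d u v : ℕ → ℤ) → (∀ m → NonZero (c m)) →
    (∀ m → c m * u (suc m) ≡ d m * u m) → (∀ m → c m * v (suc m) ≡ d m * v m) →
    u 0 ≡ v 0 → ∀ m → u m ≡ v m
  recurrence-unique c d u v c≢0 u-rec v-rec u₀≡v₀ zero    = u₀≡v₀
  recurrence-unique c d u v c≢0 u-rec v-rec u₀≡v₀ (suc m) = *-cancelˡ-≡ (c m) _ _ {{c≢0 m}} (begin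
    c m * u (suc m) ≡⟨ u-rec m ⟩
    d m * u m       ≡⟨ cong (d m *_) (recurrence-unique c d u v c≢0 u-rec v-rec u₀≡v₀ m) ⟩
    d m * v m       ≡⟨ v-rec m ⟨
    c m * v (suc m) ∎)

  dixonSum-odd : ∀ m → dixonSum (suc (2 ℕ.* m)) ≡ 0ℤ
  dixonSum-odd = recurrence-unique (α ∘ odd) (λ m → - κ (odd m)) (dixonSum ∘ odd) (λ _ → 0ℤ) (λ _ → _)
    (λ m → trans (cong (λ k → α (odd m) * dixonSum (suc k)) (ℕ.*-suc 2 m)) (dixonSum-recurrence (odd m)))
    (λ m → trans (*-zeroʳ (α (odd m))) (sym (*-zeroʳ (- κ (odd m)))))
    refl
    where
    odd : ℕ → ℕ
    odd m = suc (2 ℕ.* m)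

  trinomial-recurrence-ℤ : ∀ m → let μ = + m in
    (1ℤ + μ) * (1ℤ + μ) * + trinomial (suc m) ≡ + 3 * (1ℤ + + 3 * μ) * (+ 2 + + 3 * μ) * + trinomial m
  trinomial-recurrence-ℤ m = begin
    + suc m * + suc m * + trinomial (suc m)
      ≡⟨ cong (_* + trinomial (suc m)) (pos-* (suc m) (suc m)) ⟨
    + (suc m ℕ.* suc m) * + trinomial (suc m)
      ≡⟨ pos-* (suc m ℕ.* suc m) (trinomial (suc m)) ⟨
    + (suc m ℕ.* suc m ℕ.* trinomial (suc m))
      ≡⟨ cong +_ (trinomial-recurrence m) ⟩
    + (3 ℕ.* suc (3 ℕ.* m) ℕ.* suc (suc (3 ℕ.* m)) ℕ.* trinomial m)
      ≡⟨ pos-* (3 ℕ.* suc (3 ℕ.* m) ℕ.* suc (suc (3 ℕ.* m))) (trinomial m) ⟩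
    + (3 ℕ.* suc (3 ℕ.* m) ℕ.* suc (suc (3 ℕ.* m))) * + trinomial m
      ≡⟨ cong (_* + trinomial m) (trans (pos-* (3 ℕ.* suc (3 ℕ.* m)) (suc (suc (3 ℕ.* m))))
                                        (cong (_* + suc (suc (3 ℕ.* m))) (pos-* 3 (suc (3 ℕ.* m))))) ⟩
    + 3 * + suc (3 ℕ.* m) * + suc (suc (3 ℕ.* m)) * + trinomial m
      ≡⟨ cong (λ z → + 3 * (1ℤ + z) * (+ 2 + z) * + trinomial m) (pos-* 3 m) ⟩
    + 3 * (1ℤ + + 3 * + m) * (+ 2 + + 3 * + m) * + trinomial m ∎

  dixonSum-even : ∀ m → dixonSum (2 ℕ.* m) ≡ -1ℤ ^ m * + trinomial m
  dixonSum-even = recurrence-unique (α ∘ (2 ℕ.*_)) (λ m → - κ (2 ℕ.* m)) (dixonSum ∘ (2 ℕ.*_))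
                                   (λ m → -1ℤ ^ m * + trinomial m) (λ _ → _)
    (λ m → trans (cong (λ k → α (2 ℕ.* m) * dixonSum k) (ℕ.*-suc 2 m)) (dixonSum-recurrence (2 ℕ.* m)))
    (λ m → even-step (+ m) (+ (2 ℕ.* m)) (-1ℤ ^ m) (+ trinomial (suc m)) (+ trinomial m)
                     (pos-* 2 m) (trinomial-recurrence-ℤ m))
    refl
    where
    even-step : ∀ μ ν σ τ₁ τ₀ → ν ≡ + 2 * μ →
      (1ℤ + μ) * (1ℤ + μ) * τ₁ ≡ + 3 * (1ℤ + + 3 * μ) * (+ 2 + + 3 * μ) * τ₀ →
      (+ 2 + ν) * (+ 2 + ν) * (-1ℤ * σ * τ₁) ≡ - (+ 3 * (+ 3 * (1ℤ + ν) - 1ℤ) * (+ 3 * (1ℤ + ν) + 1ℤ)) * (σ * τ₀)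
    even-step μ .(+ 2 * μ) σ τ₁ τ₀ refl rec = begin
      (+ 2 + + 2 * μ) * (+ 2 + + 2 * μ) * (-1ℤ * σ * τ₁)          ≡⟨ solve (μ ∷ σ ∷ τ₁ ∷ []) ⟩
      - (+ 4 * σ) * ((1ℤ + μ) * (1ℤ + μ) * τ₁)                     ≡⟨ cong (- (+ 4 * σ) *_) rec ⟩
      - (+ 4 * σ) * (+ 3 * (1ℤ + + 3 * μ) * (+ 2 + + 3 * μ) * τ₀)  ≡⟨ solve (μ ∷ σ ∷ τ₀ ∷ []) ⟩
      - (+ 3 * (+ 3 * (1ℤ + + 2 * μ) - 1ℤ) * (+ 3 * (1ℤ + + 2 * μ) + 1ℤ)) * (σ * τ₀) ∎

  ∑<-dixonTerm : ∀ n → ∑< n (dixonTerm n) ≡ dixonSum n - -1ℤ ^ n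
  ∑<-dixonTerm n = begin
    ∑< n (dixonTerm n)                                 ≡⟨ +-identityʳ _ ⟨
    ∑< n (dixonTerm n) + 0ℤ                            ≡⟨ cong (λ z → ∑< n (dixonTerm n) + z) (+-inverseʳ (-1ℤ ^ n)) ⟨
    ∑< n (dixonTerm n) + (-1ℤ ^ n - -1ℤ ^ n)           ≡⟨ +-assoc (∑< n (dixonTerm n)) (-1ℤ ^ n) (- (-1ℤ ^ n)) ⟨
    ∑< n (dixonTerm n) + -1ℤ ^ n - -1ℤ ^ n             ≡⟨ cong (λ z → ∑< n (dixonTerm n) + z - -1ℤ ^ n) diagonal ⟨
    dixonSum n - -1ℤ ^ n                               ∎
    where
    diagonal : dixonTerm n n ≡ -1ℤ ^ n
    diagonal = trans (cong (λ z → -1ℤ ^ n * (+ z * + z * + z)) (nCn≡1 n)) (*-identityʳ (-1ℤ ^ n))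

  [-1]^[2m]≡1 : ∀ m → -1ℤ ^ (2 ℕ.* m) ≡ 1ℤ
  [-1]^[2m]≡1 m = trans (sym (^-*-assoc -1ℤ 2 m)) (^-zeroˡ m)

  [-1]^[1+2m]≡-1 : ∀ m → -1ℤ ^ suc (2 ℕ.* m) ≡ -1ℤ
  [-1]^[1+2m]≡-1 m = cong (-1ℤ *_) ([-1]^[2m]≡1 m)

module _ where

  open import Data.Nat.Base using (ℕ; zero; suc; _∸_; _<_)
  open import Data.Nat.Properties using (m<n⇒0<n∸m)
  open import Data.Nat.Combinatorics using (_C_)
  open import Data.Integer.Base as ℤ using (ℤ; +_; 1ℤ; -1ℤ)
  open import Data.Integer.Properties using (pos-*; +-*-semiring)
  open import Data.Integer.Tactic.RingSolver using (solve-∀)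
  open import Data.Rational.Base using (ℚ; _/_; _+_; _-_; -_; toℚᵘ)
  open import Data.Rational.Properties
    using (+-0-commutativeMonoid; toℚᵘ-injective; toℚᵘ-fromℚᵘ; toℚᵘ-homo-+; toℚᵘ-homo‿-)
  open import Data.Rational.Unnormalised.Base as ℚᵘ using (mkℚᵘ; *≡*) renaming (_≃_ to _≃ᵘ_)
  import Data.Rational.Unnormalised.Properties as ℚᵘ
  open import Relation.Binary.PropositionalEquality using (_≡_; refl; sym; trans; cong; module ≡-Reasoning)
  open CommutativeMonoidSum +-0-commutativeMonoid
  module ℤΣ = SemiringSum +-*-semiring

  fromℤ : ℤ → ℚ
  fromℤ z = z / 1

  toℚᵘ-fromℤ : ∀ z → toℚᵘ (fromℤ z) ≃ᵘ mkℚᵘ z 0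
  toℚᵘ-fromℤ z = toℚᵘ-fromℚᵘ (mkℚᵘ z 0)

  fromℤ-homo-+ : ∀ a b → fromℤ (a ℤ.+ b) ≡ fromℤ a + fromℤ b
  fromℤ-homo-+ a b = toℚᵘ-injective (begin
    toℚᵘ (fromℤ (a ℤ.+ b))                   ≈⟨ toℚᵘ-fromℤ (a ℤ.+ b) ⟩
    mkℚᵘ (a ℤ.+ b) 0                         ≈⟨ *≡* (normalise a b) ⟩
    mkℚᵘ a 0 ℚᵘ.+ mkℚᵘ b 0                   ≈⟨ ℚᵘ.+-cong (toℚᵘ-fromℤ a) (toℚᵘ-fromℤ b) ⟨
    toℚᵘ (fromℤ a) ℚᵘ.+ toℚᵘ (fromℤ b)       ≈⟨ toℚᵘ-homo-+ (fromℤ a) (fromℤ b) ⟨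
    toℚᵘ (fromℤ a + fromℤ b)                 ∎)
    where
    open ℚᵘ.≃-Reasoning
    normalise : ∀ a b → (a ℤ.+ b) ℤ.* + 1 ≡ (a ℤ.* + 1 ℤ.+ b ℤ.* + 1) ℤ.* + 1
    normalise = solve-∀

  fromℤ-homo-minus : ∀ a b → fromℤ (a ℤ.- b) ≡ fromℤ a - fromℤ b
  fromℤ-homo-minus a b = toℚᵘ-injective (begin
    toℚᵘ (fromℤ (a ℤ.- b))                   ≈⟨ toℚᵘ-fromℤ (a ℤ.- b) ⟩
    mkℚᵘ (a ℤ.- b) 0                         ≈⟨ *≡* (normalise a b) ⟩
    mkℚᵘ a 0 ℚᵘ.- mkℚᵘ b 0                   ≈⟨ ℚᵘ.+-cong (toℚᵘ-fromℤ a) (ℚᵘ.-‿cong (toℚᵘ-fromℤ b)) ⟨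
    toℚᵘ (fromℤ a) ℚᵘ.- toℚᵘ (fromℤ b)       ≈⟨ ℚᵘ.+-cong (ℚᵘ.≃-refl {toℚᵘ (fromℤ a)}) (toℚᵘ-homo‿- (fromℤ b)) ⟨
    toℚᵘ (fromℤ a) ℚᵘ.+ toℚᵘ (- fromℤ b)     ≈⟨ toℚᵘ-homo-+ (fromℤ a) (- fromℤ b) ⟨
    toℚᵘ (fromℤ a - fromℤ b)                 ∎)
    where
    open ℚᵘ.≃-Reasoning
    normalise : ∀ a b → (a ℤ.- b) ℤ.* + 1 ≡ (a ℤ.* + 1 ℤ.+ ℤ.- b ℤ.* + 1) ℤ.* + 1
    normalise = solve-∀

  fromℤ-∑< : ∀ n f → ∑[ j < n ] fromℤ (f j) ≡ fromℤ (ℤΣ.∑< n f)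
  fromℤ-∑< zero    f = refl
  fromℤ-∑< (suc n) f = trans (cong (_+ fromℤ (f n)) (fromℤ-∑< n f)) (sym (fromℤ-homo-+ (ℤΣ.∑< n f) (f n)))

  toℚᵘ-× : ∀ k z d → toℚᵘ (k × (z / suc d)) ≃ᵘ mkℚᵘ (+ k ℤ.* z) d
  toℚᵘ-× zero    z d = *≡* refl
  toℚᵘ-× (suc k) z d = begin
    toℚᵘ (z / suc d + k × (z / suc d))           ≈⟨ toℚᵘ-homo-+ (z / suc d) (k × (z / suc d)) ⟩
    toℚᵘ (z / suc d) ℚᵘ.+ toℚᵘ (k × (z / suc d)) ≈⟨ ℚᵘ.+-cong (toℚᵘ-fromℚᵘ (mkℚᵘ z d)) (toℚᵘ-× k z d) ⟩
    mkℚᵘ z d ℚᵘ.+ mkℚᵘ (+ k ℤ.* z) d             ≈⟨ *≡* (trans (normalise (+ k) z (+ suc d))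
                                                                 (cong (+ suc k ℤ.* z ℤ.*_) (sym (pos-* (suc d) (suc d))))) ⟩
    mkℚᵘ (+ suc k ℤ.* z) d                       ∎
    where
    open ℚᵘ.≃-Reasoning
    normalise : ∀ k z e → (z ℤ.* e ℤ.+ k ℤ.* z ℤ.* e) ℤ.* e ≡ (1ℤ ℤ.+ k) ℤ.* z ℤ.* (e ℤ.* e)
    normalise = solve-∀

  ×-frac : ∀ d z → 0 < d → d × frac z d ≡ fromℤ z
  ×-frac (suc d) z _ = toℚᵘ-injective (begin
    toℚᵘ (suc d × (z / suc d)) ≈⟨ toℚᵘ-× (suc d) z d ⟩
    mkℚᵘ (+ suc d ℤ.* z) d      ≈⟨ *≡* (normalise (+ suc d) z) ⟩
    mkℚᵘ z 0                    ≈⟨ toℚᵘ-fromℤ z ⟨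
    toℚᵘ (fromℤ z)             ∎)
    where
    open ℚᵘ.≃-Reasoning
    normalise : ∀ e z → e ℤ.* z ℤ.* + 1 ≡ z ℤ.* e
    normalise = solve-∀

  sumBelow≡∑< : ∀ n f → sumBelow n f ≡ ∑< n f
  sumBelow≡∑< zero    f = refl
  sumBelow≡∑< (suc n) f = cong (_+ f n) (sumBelow≡∑< n f)

  S-dixonSum : ∀ n → S n ≡ fromℤ (dixonSum n) - fromℤ (-1ℤ ℤ.^ n)
  S-dixonSum n = begin
    S n                                                ≡⟨⟩
    sumBelow n (λ k → sumBelow (suc k) (term n))       ≡⟨ sumBelow≡∑< n _ ⟩
    ∑[ k < n ] sumBelow (suc k) (term n)               ≡⟨ ∑<-cong n (λ {k} _ → sumBelow≡∑< (suc k) (term n)) ⟩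
    ∑[ k < n ] ∑< (suc k) (term n)                     ≡⟨ ∑<-triangle n (term n) ⟩
    ∑[ j < n ] ((n ∸ j) × term n j)                    ≡⟨ ∑<-cong n weight-cancels ⟩
    ∑[ j < n ] fromℤ (dixonTerm n j)                   ≡⟨ fromℤ-∑< n (dixonTerm n) ⟩
    fromℤ (ℤΣ.∑< n (dixonTerm n))                      ≡⟨ cong fromℤ (∑<-dixonTerm n) ⟩
    fromℤ (dixonSum n ℤ.- -1ℤ ℤ.^ n)                   ≡⟨ fromℤ-homo-minus (dixonSum n) (-1ℤ ℤ.^ n) ⟩
    fromℤ (dixonSum n) - fromℤ (-1ℤ ℤ.^ n)             ∎
    where
    open ≡-Reasoning
    weight-cancels : ∀ {j} → j < n → (n ∸ j) × term n j ≡ fromℤ (dixonTerm n j)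
    weight-cancels {j} j<n = trans (×-frac (n ∸ j) _ (m<n⇒0<n∸m j<n))
                                   (cong (λ z → fromℤ (-1ℤ ℤ.^ j ℤ.* z)) (pos-cube (n C j)))

open import Data.Nat using (ℕ; _+_; _*_)
open import Data.Integer using (+_; -1ℤ) renaming (_*_ to _*ℤ_; _^_ to _^ℤ_)
open import Data.Rational using (ℚ; 1ℚ; _/_; _-_)
open import Data.Nat.Combinatorics using (_C_)
open import Data.Product using (_×_; _,_)
open import Relation.Binary.PropositionalEquality using (_≡_)
open import Data.Integer using (0ℤ; 1ℤ)
open import Data.Nat.Properties using (+-comm)
open import Relation.Binary.PropositionalEquality using (cong; cong₂; module ≡-Reasoning)

proposition18 :
    ((m : ℕ) → S (2 * m) ≡ ((-1ℤ ^ℤ m) *ℤ (+ (((2 * m) C m) * ((3 * m) C (2 * m))))) / 1 - 1ℚ)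
    × ((m : ℕ) → S (2 * m + 1) ≡ 1ℚ)
proposition18 =
  (λ m → begin
    S (2 * m)
      ≡⟨ S-dixonSum (2 * m) ⟩
    fromℤ (dixonSum (2 * m)) - fromℤ (-1ℤ ^ℤ (2 * m))
      ≡⟨ cong₂ (λ a b → fromℤ a - fromℤ b) (dixonSum-even m) ([-1]^[2m]≡1 m) ⟩
    fromℤ (-1ℤ ^ℤ m *ℤ + trinomial m) - fromℤ 1ℤ ∎) ,
  (λ m → begin
    S (2 * m + 1)
      ≡⟨ cong S (+-comm (2 * m) 1) ⟩
    S (1 + 2 * m)
      ≡⟨ S-dixonSum (1 + 2 * m) ⟩
    fromℤ (dixonSum (1 + 2 * m)) - fromℤ (-1ℤ ^ℤ (1 + 2 * m))
      ≡⟨ cong₂ (λ a b → fromℤ a - fromℤ b) (dixonSum-odd m) ([-1]^[1+2m]≡-1 m) ⟩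
    fromℤ 0ℤ - fromℤ -1ℤ
      ≡⟨⟩
    1ℚ ∎)
  where open ≡-Reasoning
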